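{- Let $A$ be a finite commutative unital ring and $x\in A\setminus\{0_A\}$. (i) The $x$-quasi-monomial minimal solution of $(E_A)$ is irreducible. (ii) The $(x,A)$-monomial minimal solution of $(E_A)$ is irreducible if and only if it is equal to the $x$-quasi-monomial minimal solution of $(E_A)$.
   Context: $0_A\neq 1_A$. For $a_1,\ldots,a_n\in A$ set $M_n(a_1,\ldots,a_n)=\begin{pmatrix} a_n & -1_A\\ 1_A & 0_A\end{pmatrix}\cdots\begin{pmatrix} a_1 & -1_A\\ 1_A & 0_A\end{pmatrix}$. An $n$-tuple is a solution of $(E_A)$ if $M_n(a_1,\ldots,a_n)=\pm \mathrm{Id}$. For tuples, $(a_1,\ldots,a_n)\oplus(b_1,\ldots,b_m)=(a_1+b_m,a_2,\ldots,a_{n-1},a_n+b_1,b_2,\ldots,b_{m-1})$. Write $(a_1,\ldots,a_n)\sim(b_1,\ldots,b_n)$ if $(b_1,\ldots,b_n)$ is obtained from $(a_1,\ldots,a_n)$ or from $(a_n,\ldots,a_1)$ by a cyclic permutation. A solution $(c_1,\ldots,c_n)$ with $n\geq 3$ is reducible if there exist a solution $(b_1,\ldots,b_l)$ and a tuple $(a_1,\ldots,a_m)$ with $l,m\geq 3$ and $(c_1,\ldots,c_n)\sim(a_1,\ldots,a_m)\oplus(b_1,\ldots,b_l)$; otherwise irreducible. The $(x,A)$-monomial minimal solution is the solution all of whose components equal $x$, of minimal size. An $x$-quasi-monomial solution is a solution of $(E_A)$ of the form $(a,x,\ldots,x,a)$ (length $\geq 3$, first and last entries equal to some $a\in A$,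 all other entries equal to $x$); the $x$-quasi-monomial minimal solution is the $x$-quasi-monomial solution of minimal length, which exists and is unique. -}

module Defs where

open import Level using (Level; _⊔_)
open import Algebra.Bundles using (CommutativeRing)
open import Data.Nat using (ℕ; suc; _≤_; _<_)
open import Data.Fin using (Fin)
open import Data.List using (List; []; _∷_; _++_; [_]; length; replicate; reverse; drop; take; foldl)
open import Data.List.Relation.Binary.Pointwise using (Pointwise)
open import Data.Product using (Σ; _×_; ∃; ∃-syntax)
open import Data.Sum using (_⊎_)
open import Relation.Nullary using (¬_)
open import Relation.Binary.PropositionalEquality using (_≡_)

module _ {c ℓ : Level} (R : CommutativeRing c ℓ) where
  open CommutativeRing R

  record Finite : Set (c ⊔ ℓ) where
    field
      size    : ℕ
      to      : Carrier → Fin size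
      from    : Fin size → Carrier
      to-cong : ∀ {a b} → a ≈ b → to a ≡ to b
      from-to : ∀ a → from (to a) ≈ a
      to-from : ∀ i → to (from i) ≡ i

  record Mat : Set c where
    constructor mat
    field
      m11 m12 m21 m22 : Carrier

  _⊗_ : Mat → Mat → Mat
  mat a b c' d ⊗ mat e f g h =
    mat (a * e + b * g) (a * f + b * h) (c' * e + d * g) (c' * f + d * h)

  _≈M_ : Mat → Mat → Set ℓ
  mat a b c' d ≈M mat e f g h = (a ≈ e) × (b ≈ f) × (c' ≈ g) × (d ≈ h)

  IdM : Mat
  IdM = mat 1# 0# 0# 1#

  -IdM : Mat
  -IdM = mat (- 1#) 0# 0# (- 1#)

  Gen : Carrier → Mat
  Gen a = mat a (- 1#) 1# 0#

  -- M_n(a_1,...,a_n) = Gen a_n ⊗ ... ⊗ Gen a_1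
  Mn : List Carrier → Mat
  Mn = foldl (λ acc a → Gen a ⊗ acc) IdM

  IsSolution : List Carrier → Set ℓ
  IsSolution t = (Mn t ≈M IdM) ⊎ (Mn t ≈M -IdM)

  ⊕-tuple : Carrier → List Carrier → Carrier → Carrier → List Carrier → Carrier → List Carrier
  ⊕-tuple a₁ amid aₙ b₁ bmid bₘ = (a₁ + bₘ) ∷ amid ++ ((aₙ + b₁) ∷ bmid)

  rotate : ℕ → List Carrier → List Carrier
  rotate k l = drop k l ++ take k l

  _∼_ : List Carrier → List Carrier → Set (c ⊔ ℓ)
  t ∼ u = ∃[ k ] (Pointwise _≈_ u (rotate k t) ⊎ Pointwise _≈_ u (rotate k (reverse t)))

  Reducible : List Carrier → Set (c ⊔ ℓ)
  Reducible t =
    ∃[ a₁ ] ∃[ amid ] ∃[ aₙ ] ∃[ b₁ ] ∃[ bmid ] ∃[ bₘ ]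
      (1 ≤ length amid) × (1 ≤ length bmid) ×
      IsSolution (b₁ ∷ bmid ++ [ bₘ ]) ×
      (t ∼ ⊕-tuple a₁ amid aₙ b₁ bmid bₘ)

  Irreducible : List Carrier → Set (c ⊔ ℓ)
  Irreducible t = IsSolution t × (3 ≤ length t) × ¬ Reducible t

  IsMonomialMinimalSize : Carrier → ℕ → Set ℓ
  IsMonomialMinimalSize x n =
    IsSolution (replicate n x) × (1 ≤ n) ×
    (∀ m → 1 ≤ m → m < n → ¬ IsSolution (replicate m x))

  IsQuasiMonomial : Carrier → List Carrier → Set (c ⊔ ℓ)
  IsQuasiMonomial x t =
    ∃[ a ] ∃[ k ] (1 ≤ k) × (t ≡ a ∷ replicate k x ++ [ a ]) × IsSolution t

  IsQuasiMonomialMinimal : Carrier → List Carrier → Set (c ⊔ ℓ)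
  IsQuasiMonomialMinimal x t =
    IsQuasiMonomial x t × (∀ u → IsQuasiMonomial x u → length t ≤ length u)

{-# OPTIONS --safe #-}
-- (i) Let t = (a, x, ..., x, a) be the minimal x-quasi-monomial solution and
-- suppose t ∼ A ⊕ B with B a solution. Splitting a junction entry p + q into
-- (q, 0, p) only changes M by the sign -Id, and solutions are closed under
-- rotation, so A is a solution too. The two entries a of t are cyclically
-- adjacent, hence the interior of A or of B consists of x's only. As
-- M(x, ..., x) commutes with the generator of x, its off-diagonal entries are
-- opposite, which forces the two ends of a solution (p, x, ..., x, q) to be
-- equal. So A or B is an x-quasi-monomial solution shorter than t.
-- (ii) If an x-quasi-monomial solution B = (a, x, ..., x, a) is shorter than
-- (x, ..., x), then (x, ..., x) ∼ (x - a, x, ..., x, x - a) ⊕ B is reducible;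
-- the converse is (i).

module Submission where

open import Defs
open import Algebra.Bundles using (CommutativeRing)
open import Data.List using (List; replicate)
open import Data.Product using (_×_)
open import Relation.Nullary using (¬_)
open import Function.Bundles using (_⇔_)

open import Data.Nat using (ℕ; suc; _≤_; _<_; s≤s; z≤n)
import Data.Nat as ℕ
open import Data.Nat.Properties using (≤-pred; <⇒≱; ≮⇒≥; m<m+n; m<n+m; m≤n⇒∃[o]m+o≡n)
import Data.Nat.Properties as ℕₚ
open import Data.List using ([]; _∷_; _++_; [_]; length; foldl; drop; take; reverse)
open import Data.List.Properties
  using (foldl-++; ++-assoc; ++-identityʳ; length-++; length-++-comm; length-replicate; take++drop≡id;
         drop-[]; take-[]; reverse-++; unfold-reverse)
open import Data.List.Relation.Unary.All using (All; []; _∷_)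
open import Data.List.Relation.Binary.Pointwise as Pointwise
  using (Pointwise; []; _∷_; ++⁺; Pointwise-length)
open import Data.Vec using (Vec; []; _∷_; map; allFin)
open import Data.Vec.N-ary using (N-ary; _$ⁿ_)
open import Data.Product using (_,_; proj₁; proj₂; ∃-syntax; ∃₂)
import Data.Product as Product
open import Data.Sum using (_⊎_; inj₁; inj₂; [_,_]′)
import Data.Sum as Sum
open import Function.Bundles using (mk⇔)
open import Function using (id)
open import Relation.Binary.Bundles using (Setoid)
import Relation.Binary.Reasoning.Setoid as SetoidReasoning
open import Relation.Binary.PropositionalEquality as ≡ using (_≡_)

module _ {a} {A : Set a} where

  replicate-+ : ∀ m n (x : A) → replicate (m ℕ.+ n) x ≡ replicate m x ++ replicate n x
  replicate-+ 0 n x = ≡.refl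
  replicate-+ (suc m) n x = ≡.cong (x ∷_) (replicate-+ m n x)

  replicate-∷ʳ : ∀ n (x : A) → replicate n x ++ [ x ] ≡ x ∷ replicate n x
  replicate-∷ʳ 0 x = ≡.refl
  replicate-∷ʳ (suc n) x = ≡.cong (x ∷_) (replicate-∷ʳ n x)

  reverse-replicate : ∀ n (x : A) → reverse (replicate n x) ≡ replicate n x
  reverse-replicate 0 x = ≡.refl
  reverse-replicate (suc n) x = begin
    reverse (x ∷ replicate n x)     ≡⟨ unfold-reverse x (replicate n x) ⟩
    reverse (replicate n x) ++ [ x ] ≡⟨ ≡.cong (_++ [ x ]) (reverse-replicate n x) ⟩
    replicate n x ++ [ x ]           ≡⟨ replicate-∷ʳ n x ⟩
    x ∷ replicate n x                ∎
    where open ≡.≡-Reasoning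

  length-rotate : ∀ k (l : List A) → length (drop k l ++ take k l) ≡ length l
  length-rotate k l = ≡.trans (length-++-comm (drop k l) (take k l)) (≡.cong length (take++drop≡id k l))

1+m+1+n≰2+m : ∀ m {n} → 1 ≤ n → ¬ suc (m ℕ.+ suc n) ≤ suc (suc m)
1+m+1+n≰2+m m 1≤n le =
  <⇒≱ (m<m+n m 1≤n) (≤-pred (≡.subst (_≤ suc m) (ℕₚ.+-suc m _) (≤-pred le)))

1+m+1+n≰2+n : ∀ {m} n → 1 ≤ m → ¬ suc (m ℕ.+ suc n) ≤ suc (suc n)
1+m+1+n≰2+n n 1≤m le = <⇒≱ (m<n+m (suc n) 1≤m) (≤-pred le)

module Arcs {a ℓ} (S : Setoid a ℓ) (x : Setoid.Carrier S) where
  open Setoid S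

  Pointwise-replicate⇒All≈ : ∀ {l n} → Pointwise _≈_ l (replicate n x) → All (_≈ x) l
  Pointwise-replicate⇒All≈ {n = 0} [] = []
  Pointwise-replicate⇒All≈ {n = suc n} (e ∷ es) = e ∷ Pointwise-replicate⇒All≈ es

  All≈⇒Pointwise-replicate : ∀ {l} → All (_≈ x) l → Pointwise _≈_ l (replicate (length l) x)
  All≈⇒Pointwise-replicate [] = []
  All≈⇒Pointwise-replicate (e ∷ es) = e ∷ All≈⇒Pointwise-replicate es

  after-mark-≈x : ∀ {y g v} q w → Pointwise _≈_ (w ++ g ∷ v) (y ∷ replicate q x) → All (_≈ x) v
  after-mark-≈x q [] (_ ∷ v≈) = Pointwise-replicate⇒All≈ v≈
  after-mark-≈x (suc q) (_ ∷ w) (_ ∷ rest) = after-mark-≈x q w rest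
  after-mark-≈x 0 (_ ∷ []) (_ ∷ ())
  after-mark-≈x 0 (_ ∷ _ ∷ _) (_ ∷ ())

  before-mark-≈x : ∀ {b g v s} p u → Pointwise _≈_ (u ++ g ∷ v) (replicate p x ++ b ∷ s) →
                   All (_≈ x) u ⊎ ∃[ w ] Pointwise _≈_ (w ++ g ∷ v) s
  before-mark-≈x p [] _ = inj₁ []
  before-mark-≈x 0 (_ ∷ u) (_ ∷ rest) = inj₂ (u , rest)
  before-mark-≈x (suc p) (_ ∷ u) (e ∷ rest) = Sum.map₁ (e ∷_) (before-mark-≈x p u rest)

  arcs-between-ends : ∀ K {b h g u v} →
                      Pointwise _≈_ (h ∷ u ++ g ∷ v) (b ∷ replicate K x ++ [ b ]) → All (_≈ x) u
  arcs-between-ends K {u = u} (_ ∷ rest) with before-mark-≈x K u rest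
  ... | inj₁ u≈x = u≈x
  ... | inj₂ ([] , ())
  ... | inj₂ (_ ∷ _ , ())

  arcs-around-adjacent : ∀ p q {b h g u v} →
                         Pointwise _≈_ (h ∷ u ++ g ∷ v) (replicate p x ++ b ∷ b ∷ replicate q x) →
                         All (_≈ x) u ⊎ All (_≈ x) v
  arcs-around-adjacent 0 q {u = u} (_ ∷ rest) = inj₂ (after-mark-≈x q u rest)
  arcs-around-adjacent (suc p) q {u = u} (_ ∷ rest) =
    Sum.map₂ (λ (w , rest′) → after-mark-≈x q w rest′) (before-mark-≈x p u rest)

  drop-take-replicate-∷ʳ : ∀ b k K →
    let l = replicate K x ++ [ b ] in
    (drop k l ≡ [] × take k l ≡ l) ⊎
    ∃₂ λ p q → drop k l ≡ replicate p x ++ [ b ] × take k l ≡ replicate q x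
  drop-take-replicate-∷ʳ b 0 K = inj₂ (K , 0 , ≡.refl , ≡.refl)
  drop-take-replicate-∷ʳ b (suc k) 0 = inj₁ (drop-[] k , ≡.cong (b ∷_) (take-[] k))
  drop-take-replicate-∷ʳ b (suc k) (suc K) =
    Sum.map (Product.map₂ (≡.cong (x ∷_))) (λ (p , q , d , t) → p , suc q , d , ≡.cong (x ∷_) t)
      (drop-take-replicate-∷ʳ b k K)

  rotate-quasiMonomial : ∀ b K k → let t = b ∷ replicate K x ++ [ b ] in
    drop k t ++ take k t ≡ t ⊎
    ∃₂ λ p q → drop k t ++ take k t ≡ replicate p x ++ b ∷ b ∷ replicate q x
  rotate-quasiMonomial b K 0 = inj₁ (++-identityʳ _)
  rotate-quasiMonomial b K (suc k) with drop-take-replicate-∷ʳ b k K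
  ... | inj₁ (d , t) = inj₁ (≡.cong₂ (λ l l′ → l ++ b ∷ l′) d t)
  ... | inj₂ (p , q , d , t) =
    inj₂ (p , q , ≡.trans (≡.cong₂ (λ l l′ → l ++ b ∷ l′) d t) (++-assoc (replicate p x) [ b ] _))

  -- The two entries b of the cyclic word (b, x, ..., x, b) are adjacent, so the
  -- marks h and g cannot separate them: one of the arcs u, v avoids both.
  arcs : ∀ b K k {h g u v} → let t = b ∷ replicate K x ++ [ b ] in
         Pointwise _≈_ (h ∷ u ++ g ∷ v) (drop k t ++ take k t) → All (_≈ x) u ⊎ All (_≈ x) v
  arcs b K k c≈ with rotate-quasiMonomial b K k
  ... | inj₁ eq = inj₁ (arcs-between-ends K (≡.subst (Pointwise _≈_ _) eq c≈))
  ... | inj₂ (p , q , eq) = arcs-around-adjacent p q (≡.subst (Pointwise _≈_ _) eq c≈)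

module Matrices {c ℓ} (R : CommutativeRing c ℓ) where
  open CommutativeRing R
  open import Algebra.Properties.Ring ring using (-1*x≈-x)
  open import Algebra.Properties.Group +-group using (⁻¹-involutive; x∙y⁻¹≈ε⇒x≈y)
  open import Algebra.Solver.Ring.NaturalCoefficients.Default commutativeSemiring
    using (Polynomial; var; con; _:+_; _:*_; ⟦_⟧; ⟦_⟧↓; prove; solve; _:=_)
  module ≈-Reasoning = SetoidReasoning setoid

  infixl 7 _·_
  infix 4 _≋_

  _·_ : Mat R → Mat R → Mat R
  _·_ = _⊗_ R

  _≋_ : Mat R → Mat R → Set ℓ
  _≋_ = _≈M_ R

  scalar : Carrier → Mat R
  scalar s = mat s 0# 0# s

  I -I : Mat R
  I = IdM R
  -I = -IdM R

  G : Carrier → Mat R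
  G = Gen R

  G⁻¹ : Carrier → Mat R
  G⁻¹ a = mat 0# 1# (- 1#) a

  ≋-setoid : Setoid c ℓ
  ≋-setoid = record
    { Carrier = Mat R
    ; _≈_ = _≋_
    ; isEquivalence = record
      { refl = refl , refl , refl , refl
      ; sym = λ (e₁ , e₂ , e₃ , e₄) → sym e₁ , sym e₂ , sym e₃ , sym e₄
      ; trans = λ (e₁ , e₂ , e₃ , e₄) (f₁ , f₂ , f₃ , f₄) →
          trans e₁ f₁ , trans e₂ f₂ , trans e₃ f₃ , trans e₄ f₄
      }
    }

  open Setoid ≋-setoid public
    using () renaming (refl to ≋-refl; sym to ≋-sym; trans to ≋-trans; reflexive to ≋-reflexive)
  module ≋-Reasoning = SetoidReasoning ≋-setoid

  ·-cong : ∀ {X X′ Y Y′} → X ≋ X′ → Y ≋ Y′ → X · Y ≋ X′ · Y′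
  ·-cong {mat _ _ _ _} {mat _ _ _ _} {mat _ _ _ _} {mat _ _ _ _} (a , b , c′ , d) (e , f , g , h) =
    +-cong (*-cong a e) (*-cong b g) , +-cong (*-cong a f) (*-cong b h) ,
    +-cong (*-cong c′ e) (*-cong d g) , +-cong (*-cong c′ f) (*-cong d h)

  scalar-cong : ∀ {s t} → s ≈ t → scalar s ≋ scalar t
  scalar-cong e = e , refl , refl , e

  G-cong : ∀ {a b} → a ≈ b → G a ≋ G b
  G-cong e = e , refl , refl , refl

  -1*-1≈1 : - 1# * - 1# ≈ 1#
  -1*-1≈1 = trans (-1*x≈-x (- 1#)) (⁻¹-involutive 1#)

  -- Matrix identities are checked entrywise by the semiring solver, to which the
  -- constant -1 is passed as an extra variable m; what is proved this way holds
  -- for every m, and the facts m * m ≈ 1 and 1 + m ≈ 0 are applied by hand.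
  record PolyMat (n : ℕ) : Set c where
    constructor pmat
    field p₁₁ p₁₂ p₂₁ p₂₂ : Polynomial n

  infixl 7 _⊠_
  _⊠_ : ∀ {n} → PolyMat n → PolyMat n → PolyMat n
  pmat a b c′ d ⊠ pmat e f g h =
    pmat (a :* e :+ b :* g) (a :* f :+ b :* h) (c′ :* e :+ d :* g) (c′ :* f :+ d :* h)

  ⟦_⟧ᴹ ⟦_⟧↓ᴹ : ∀ {n} → PolyMat n → Vec Carrier n → Mat R
  ⟦ pmat a b c′ d ⟧ᴹ ρ = mat (⟦ a ⟧ ρ) (⟦ b ⟧ ρ) (⟦ c′ ⟧ ρ) (⟦ d ⟧ ρ)
  ⟦ pmat a b c′ d ⟧↓ᴹ ρ = mat (⟦ a ⟧↓ ρ) (⟦ b ⟧↓ ρ) (⟦ c′ ⟧↓ ρ) (⟦ d ⟧↓ ρ)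

  solveᴹ : ∀ n (f : N-ary n (Polynomial n) (PolyMat n × PolyMat n)) →
           let eqn = f $ⁿ map var (allFin n) in
           (∀ ρ → ⟦ proj₁ eqn ⟧↓ᴹ ρ ≋ ⟦ proj₂ eqn ⟧↓ᴹ ρ) →
           ∀ ρ → ⟦ proj₁ eqn ⟧ᴹ ρ ≋ ⟦ proj₂ eqn ⟧ᴹ ρ
  solveᴹ n f nf ρ with f $ⁿ map var (allFin n) | nf ρ
  ... | pmat a b c′ d , pmat e f′ g h | e₁ , e₂ , e₃ , e₄ =
    prove ρ a e e₁ , prove ρ b f′ e₂ , prove ρ c′ g e₃ , prove ρ d h e₄

  Gₚ : ∀ {n} → Polynomial n → Polynomial n → PolyMat n
  Gₚ m a = pmat a m (con 1) (con 0)

  scalarₚ : ∀ {n} → Polynomial n → PolyMat n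
  scalarₚ s = pmat s (con 0) (con 0) s

  ·-assoc : ∀ X Y Z → X · Y · Z ≋ X · (Y · Z)
  ·-assoc (mat a b c′ d) (mat e f g h) (mat i j k l) =
    solveᴹ 12 (λ a b c′ d e f g h i j k l →
      let X = pmat a b c′ d ; Y = pmat e f g h ; Z = pmat i j k l in X ⊠ Y ⊠ Z , X ⊠ (Y ⊠ Z))
      (λ _ → ≋-refl) (a ∷ b ∷ c′ ∷ d ∷ e ∷ f ∷ g ∷ h ∷ i ∷ j ∷ k ∷ l ∷ [])

  scalar-comm : ∀ s X → scalar s · X ≋ X · scalar s
  scalar-comm s (mat a b c′ d) =
    solveᴹ 5 (λ s a b c′ d → scalarₚ s ⊠ pmat a b c′ d , pmat a b c′ d ⊠ scalarₚ s)
      (λ _ → ≋-refl) (s ∷ a ∷ b ∷ c′ ∷ d ∷ [])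

  ·-identityˡ : ∀ X → I · X ≋ X
  ·-identityˡ (mat a b c′ d) =
    solveᴹ 4 (λ a b c′ d → scalarₚ (con 1) ⊠ pmat a b c′ d , pmat a b c′ d)
      (λ _ → ≋-refl) (a ∷ b ∷ c′ ∷ d ∷ [])

  ·-identityʳ : ∀ X → X · I ≋ X
  ·-identityʳ (mat a b c′ d) =
    solveᴹ 4 (λ a b c′ d → pmat a b c′ d ⊠ scalarₚ (con 1) , pmat a b c′ d)
      (λ _ → ≋-refl) (a ∷ b ∷ c′ ∷ d ∷ [])

  scalar-· : ∀ s t → scalar s · scalar t ≋ scalar (s * t)
  scalar-· s t =
    solveᴹ 2 (λ s t → scalarₚ s ⊠ scalarₚ t , scalarₚ (s :* t)) (λ _ → ≋-refl) (s ∷ t ∷ [])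

  -I·-I : -I · -I ≋ I
  -I·-I = ≋-trans (scalar-· (- 1#) (- 1#)) (scalar-cong -1*-1≈1)

  G·G⁻¹ : ∀ a → G a · G⁻¹ a ≋ I
  G·G⁻¹ a = ≋-trans
    (solveᴹ 2 (λ m a → Gₚ m a ⊠ pmat (con 0) (con 1) m a ,
                       pmat (m :* m) ((con 1 :+ m) :* a) (con 0) (con 1))
      (λ _ → ≋-refl) (- 1# ∷ a ∷ []))
    (-1*-1≈1 , trans (*-congʳ (-‿inverseʳ 1#)) (zeroˡ a) , refl , refl)

  Mn-split-zero : ∀ p q → Mn R (q ∷ 0# ∷ p ∷ []) ≋ -I · Mn R [ p + q ]
  Mn-split-zero p q =
    solveᴹ 3 (λ m p q → Gₚ m p ⊠ (Gₚ m (con 0) ⊠ (Gₚ m q ⊠ scalarₚ (con 1))) ,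
                        scalarₚ m ⊠ (Gₚ m (p :+ q) ⊠ scalarₚ (con 1)))
      (λ _ → ≋-refl) (- 1# ∷ p ∷ q ∷ [])

  Mn-zeros : Mn R (0# ∷ 0# ∷ []) ≋ -I
  Mn-zeros =
    solveᴹ 1 (λ m → Gₚ m (con 0) ⊠ (Gₚ m (con 0) ⊠ scalarₚ (con 1)) , scalarₚ m)
      (λ _ → ≋-refl) (- 1# ∷ [])

  IsSign : Mat R → Set ℓ
  IsSign X = X ≋ I ⊎ X ≋ -I

  IsSign-resp : ∀ {X Y} → X ≋ Y → IsSign Y → IsSign X
  IsSign-resp e = Sum.map (≋-trans e) (≋-trans e)

  IsSign-· : ∀ {X Y} → IsSign X → IsSign Y → IsSign (X · Y)
  IsSign-· (inj₁ e) (inj₁ f) = inj₁ (≋-trans (·-cong e f) (·-identityˡ I))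
  IsSign-· (inj₁ e) (inj₂ f) = inj₂ (≋-trans (·-cong e f) (·-identityˡ -I))
  IsSign-· (inj₂ e) (inj₁ f) = inj₂ (≋-trans (·-cong e f) (·-identityʳ -I))
  IsSign-· (inj₂ e) (inj₂ f) = inj₁ (≋-trans (·-cong e f) -I·-I)

  IsSign-comm : ∀ {E} → IsSign E → ∀ X → E · X ≋ X · E
  IsSign-comm {E} sign-E X = [ comm 1# , comm (- 1#) ]′ sign-E
    where
    comm : ∀ s → E ≋ scalar s → E · X ≋ X · E
    comm s e = ≋-trans (·-cong e ≋-refl) (≋-trans (scalar-comm s X) (·-cong ≋-refl (≋-sym e)))

  IsSign-square : ∀ {E} → IsSign E → E · E ≋ I
  IsSign-square (inj₁ e) = ≋-trans (·-cong e e) (·-identityˡ I)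
  IsSign-square (inj₂ e) = ≋-trans (·-cong e e) -I·-I

  IsSign-cancelʳ : ∀ {E X} → IsSign E → IsSign (X · E) → IsSign X
  IsSign-cancelʳ {E} {X} sign-E sign-XE = IsSign-resp X≋XEE (IsSign-· sign-XE sign-E)
    where
    open ≋-Reasoning
    X≋XEE : X ≋ X · E · E
    X≋XEE = begin
      X            ≈⟨ ·-identityʳ X ⟨
      X · I        ≈⟨ ·-cong ≋-refl (IsSign-square sign-E) ⟨
      X · (E · E)  ≈⟨ ·-assoc X E E ⟨
      X · E · E    ∎

  IsSign-swap : ∀ {X Y Y′} → Y · Y′ ≋ I → IsSign (X · Y) → IsSign (Y · X)
  IsSign-swap {X} {Y} {Y′} inverse sign-XY = IsSign-resp YX≋XY sign-XY
    where
    open ≋-Reasoning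
    YX≋XY : Y · X ≋ X · Y
    YX≋XY = begin
      Y · X             ≈⟨ ·-identityʳ (Y · X) ⟨
      Y · X · I         ≈⟨ ·-cong ≋-refl inverse ⟨
      Y · X · (Y · Y′)  ≈⟨ ·-assoc (Y · X) Y Y′ ⟨
      Y · X · Y · Y′    ≈⟨ ·-cong (·-assoc Y X Y) ≋-refl ⟩
      Y · (X · Y) · Y′  ≈⟨ ·-cong (IsSign-comm sign-XY Y) ≋-refl ⟨
      X · Y · Y · Y′    ≈⟨ ·-assoc (X · Y) Y Y′ ⟩
      X · Y · (Y · Y′)  ≈⟨ ·-cong ≋-refl inverse ⟩
      X · Y · I         ≈⟨ ·-identityʳ (X · Y) ⟩
      X · Y             ∎

  ·G-comm⇒m₁₂+m₂₁≈0 : ∀ {a X} → X · G a ≋ G a · X → Mat.m12 X + Mat.m21 X ≈ 0#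
  ·G-comm⇒m₁₂+m₂₁≈0 {a} {mat α β γ δ} (_ , _ , _ , e₂₂) = begin
    β + γ                  ≈⟨ solve 3 (λ β γ δ → β :+ γ := con 1 :* β :+ con 0 :* δ :+ γ) refl β γ δ ⟩
    1# * β + 0# * δ + γ    ≈⟨ +-congʳ e₂₂ ⟨
    γ * - 1# + δ * 0# + γ
      ≈⟨ solve 3 (λ γ δ m → γ :* m :+ δ :* con 0 :+ γ := γ :* (con 1 :+ m)) refl γ δ (- 1#) ⟩
    γ * (1# + - 1#)        ≈⟨ *-congˡ (-‿inverseʳ 1#) ⟩
    γ * 0#                 ≈⟨ zeroʳ γ ⟩
    0#                     ∎
    where open ≈-Reasoning

  G·X·G≈scalar⇒≈ : ∀ {X p q s} → Mat.m12 X + Mat.m21 X ≈ 0# → s * s ≈ 1# →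
                   G q · X · G p ≋ scalar s → p ≈ q
  G·X·G≈scalar⇒≈ {mat α β γ δ} {p} {q} {s} β+γ≈0 s*s≈1 (_ , e₁₂ , e₂₁ , e₂₂) =
    x∙y⁻¹≈ε⇒x≈y p q (cancel-s s[p-q]≈0)
    where
    open ≈-Reasoning
    Y = G q · mat α β γ δ · G p
    -- When Y is the scalar s, the left side is s (p - q) and the right side is β + γ.
    certificate : Mat.m22 Y * (p + - 1# * q) + (Mat.m12 Y + Mat.m21 Y) ≈
                  (1# + - 1#) * (α * p + α * q * - 1#) + γ * (- 1# * - 1#) + β
    certificate = solve 7 (λ α β γ δ p q m →
      let Yₚ = Gₚ m q ⊠ pmat α β γ δ ⊠ Gₚ m p in
      PolyMat.p₂₂ Yₚ :* (p :+ m :* q) :+ (PolyMat.p₁₂ Yₚ :+ PolyMat.p₂₁ Yₚ)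
        := (con 1 :+ m) :* (α :* p :+ α :* q :* m) :+ γ :* (m :* m) :+ β) refl α β γ δ p q (- 1#)
    s[p-q]≈0 : s * (p + - q) ≈ 0#
    s[p-q]≈0 = begin
      s * (p + - q)                                    ≈⟨ *-congˡ (+-congˡ (-1*x≈-x q)) ⟨
      s * (p + - 1# * q)                               ≈⟨ +-identityʳ _ ⟨
      s * (p + - 1# * q) + 0#                          ≈⟨ +-congˡ (+-identityʳ 0#) ⟨
      s * (p + - 1# * q) + (0# + 0#)                   ≈⟨ +-cong (*-congʳ e₂₂) (+-cong e₁₂ e₂₁) ⟨
      Mat.m22 Y * (p + - 1# * q) + (Mat.m12 Y + Mat.m21 Y) ≈⟨ certificate ⟩
      (1# + - 1#) * (α * p + α * q * - 1#) + γ * (- 1# * - 1#) + β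
        ≈⟨ +-congʳ (+-cong (*-congʳ (-‿inverseʳ 1#)) (*-congˡ -1*-1≈1)) ⟩
      0# * (α * p + α * q * - 1#) + γ * 1# + β
        ≈⟨ solve 3 (λ t β γ → con 0 :* t :+ γ :* con 1 :+ β := β :+ γ) refl _ β γ ⟩
      β + γ                                            ≈⟨ β+γ≈0 ⟩
      0#                                               ∎
    cancel-s : ∀ {z} → s * z ≈ 0# → z ≈ 0#
    cancel-s {z} s*z≈0 = begin
      z              ≈⟨ *-identityˡ z ⟨
      1# * z         ≈⟨ *-congʳ s*s≈1 ⟨
      s * s * z      ≈⟨ *-assoc s s z ⟩
      s * (s * z)    ≈⟨ *-congˡ s*z≈0 ⟩
      s * 0#         ≈⟨ zeroʳ s ⟩
      0#             ∎

  G·X·G-sign⇒≈ : ∀ {X p q} → Mat.m12 X + Mat.m21 X ≈ 0# → IsSign (G q · X · G p) → p ≈ q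
  G·X·G-sign⇒≈ X-comm (inj₁ e) = G·X·G≈scalar⇒≈ X-comm (*-identityʳ 1#) e
  G·X·G-sign⇒≈ X-comm (inj₂ e) = G·X·G≈scalar⇒≈ X-comm -1*-1≈1 e

module Solutions {c ℓ} (R : CommutativeRing c ℓ) where
  open CommutativeRing R
  open Matrices R

  Mn-foldl : ∀ X l → foldl (λ acc a → G a · acc) X l ≋ Mn R l · X
  Mn-foldl X [] = ≋-sym (·-identityˡ X)
  Mn-foldl X (a ∷ l) = begin
    foldl (λ acc b → G b · acc) (G a · X) l  ≈⟨ Mn-foldl (G a · X) l ⟩
    Mn R l · (G a · X)                       ≈⟨ ·-cong ≋-refl (·-cong (·-identityʳ (G a)) ≋-refl) ⟨
    Mn R l · (G a · I · X)                   ≈⟨ ·-assoc (Mn R l) (G a · I) X ⟨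
    Mn R l · (G a · I) · X                   ≈⟨ ·-cong (Mn-foldl (G a · I) l) ≋-refl ⟨
    Mn R (a ∷ l) · X                         ∎
    where open ≋-Reasoning

  Mn-∷ : ∀ a l → Mn R (a ∷ l) ≋ Mn R l · G a
  Mn-∷ a l = ≋-trans (Mn-foldl (G a · I) l) (·-cong ≋-refl (·-identityʳ (G a)))

  Mn-++ : ∀ u v → Mn R (u ++ v) ≋ Mn R v · Mn R u
  Mn-++ u v = ≋-trans (≋-reflexive (foldl-++ _ I u v)) (Mn-foldl (Mn R u) v)

  Mn-∷ʳ : ∀ l a → Mn R (l ++ [ a ]) ≋ G a · Mn R l
  Mn-∷ʳ l a = ≋-reflexive (foldl-++ _ I l [ a ])

  Mn-cong : ∀ {u v} → Pointwise _≈_ u v → Mn R u ≋ Mn R v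
  Mn-cong [] = ≋-refl
  Mn-cong {a ∷ u} {b ∷ v} (a≈b ∷ u≈v) =
    ≋-trans (Mn-∷ a u) (≋-trans (·-cong (Mn-cong u≈v) (G-cong a≈b)) (≋-sym (Mn-∷ b v)))

  Mn-rightInverse : ∀ u → ∃[ U ] Mn R u · U ≋ I
  Mn-rightInverse [] = I , ·-identityˡ I
  Mn-rightInverse (a ∷ u) with Mn-rightInverse u
  ... | U , inverse = G⁻¹ a · U , (begin
    Mn R (a ∷ u) · (G⁻¹ a · U)    ≈⟨ ·-cong (Mn-∷ a u) ≋-refl ⟩
    Mn R u · G a · (G⁻¹ a · U)    ≈⟨ ·-assoc (Mn R u) (G a) (G⁻¹ a · U) ⟩
    Mn R u · (G a · (G⁻¹ a · U))  ≈⟨ ·-cong ≋-refl (·-assoc (G a) (G⁻¹ a) U) ⟨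
    Mn R u · (G a · G⁻¹ a · U)    ≈⟨ ·-cong ≋-refl (·-cong (G·G⁻¹ a) ≋-refl) ⟩
    Mn R u · (I · U)              ≈⟨ ·-cong ≋-refl (·-identityˡ U) ⟩
    Mn R u · U                    ≈⟨ inverse ⟩
    I                             ∎)
    where open ≋-Reasoning

  IsSolution-resp : ∀ u {v} → Pointwise _≈_ u v → IsSolution R v → IsSolution R u
  IsSolution-resp _ u≈v = IsSign-resp (Mn-cong u≈v)

  IsSolution-++-comm : ∀ u v → IsSolution R (u ++ v) → IsSolution R (v ++ u)
  IsSolution-++-comm u v sol = IsSign-resp (Mn-++ v u)
    (IsSign-swap (proj₂ (Mn-rightInverse u)) (IsSign-resp (≋-sym (Mn-++ u v)) sol))

  IsSolution-rotate : ∀ k t → IsSolution R t → IsSolution R (rotate R k t)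
  IsSolution-rotate k t sol =
    IsSolution-++-comm (take k t) (drop k t) (≡.subst (IsSolution R) (≡.sym (take++drop≡id k t)) sol)

  IsSolution-cancelˡ : ∀ u v → IsSolution R u → IsSolution R (u ++ v) → IsSolution R v
  IsSolution-cancelˡ u v sol-u sol-uv = IsSign-cancelʳ sol-u (IsSign-resp (≋-sym (Mn-++ u v)) sol-uv)

  IsSolution-replace : ∀ {E} w w′ → IsSign E → Mn R w ≋ E · Mn R w′ →
                       ∀ v → IsSolution R (w′ ++ v) → IsSolution R (w ++ v)
  IsSolution-replace {E} w w′ sign-E w≋Ew′ v sol = IsSign-resp chain (IsSign-· sign-E sol)
    where
    open ≋-Reasoning
    chain : Mn R (w ++ v) ≋ E · Mn R (w′ ++ v)
    chain = begin
      Mn R (w ++ v)              ≈⟨ Mn-++ w v ⟩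
      Mn R v · Mn R w            ≈⟨ ·-cong ≋-refl w≋Ew′ ⟩
      Mn R v · (E · Mn R w′)     ≈⟨ ·-assoc (Mn R v) E (Mn R w′) ⟨
      Mn R v · E · Mn R w′       ≈⟨ ·-cong (IsSign-comm sign-E (Mn R v)) ≋-refl ⟨
      E · Mn R v · Mn R w′       ≈⟨ ·-assoc E (Mn R v) (Mn R w′) ⟩
      E · (Mn R v · Mn R w′)     ≈⟨ ·-cong ≋-refl (Mn-++ w′ v) ⟨
      E · Mn R (w′ ++ v)         ∎

  IsSolution-split-zero : ∀ p q v → IsSolution R ((p + q) ∷ v) → IsSolution R (q ∷ 0# ∷ p ∷ v)
  IsSolution-split-zero p q =
    IsSolution-replace (q ∷ 0# ∷ p ∷ []) [ p + q ] (inj₂ ≋-refl) (Mn-split-zero p q)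

  IsSolution-drop-zeros : ∀ v → IsSolution R (0# ∷ 0# ∷ v) → IsSolution R v
  IsSolution-drop-zeros = IsSolution-replace [] (0# ∷ 0# ∷ []) (inj₂ ≋-refl)
    (≋-sym (≋-trans (·-cong ≋-refl Mn-zeros) -I·-I))

  -- Splitting both junction entries p + q into (q, 0, p) and rotating
  -- turns A ⊕ B into B ++ (0, A, 0).
  IsSolution-⊕ : ∀ a₁ amid aₙ b₁ bmid bₘ →
                 IsSolution R (⊕-tuple R a₁ amid aₙ b₁ bmid bₘ) →
                 IsSolution R (b₁ ∷ bmid ++ [ bₘ ]) →
                 IsSolution R (a₁ ∷ amid ++ [ aₙ ])
  IsSolution-⊕ a₁ amid aₙ b₁ bmid bₘ sol-c sol-b =
    IsSolution-drop-zeros a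
      (IsSolution-++-comm (0# ∷ a) [ 0# ] (IsSolution-cancelˡ b (0# ∷ a ++ [ 0# ]) sol-b sol-b0a0))
    where
    a = a₁ ∷ amid ++ [ aₙ ]
    b = b₁ ∷ bmid ++ [ bₘ ]
    split₁ : IsSolution R (bₘ ∷ 0# ∷ a₁ ∷ amid ++ (aₙ + b₁) ∷ bmid)
    split₁ = IsSolution-split-zero a₁ bₘ (amid ++ (aₙ + b₁) ∷ bmid) sol-c
    split₂ : IsSolution R (aₙ ∷ 0# ∷ b₁ ∷ bmid ++ bₘ ∷ 0# ∷ a₁ ∷ amid)
    split₂ = IsSolution-split-zero b₁ aₙ rest
      (IsSolution-resp ((b₁ + aₙ) ∷ rest) (+-comm b₁ aₙ ∷ Pointwise.refl refl)
        (IsSolution-++-comm (bₘ ∷ 0# ∷ a₁ ∷ amid) ((aₙ + b₁) ∷ bmid) split₁))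
      where rest = bmid ++ bₘ ∷ 0# ∷ a₁ ∷ amid
    reassoc : (b₁ ∷ bmid ++ bₘ ∷ 0# ∷ a₁ ∷ amid) ++ aₙ ∷ 0# ∷ [] ≡ b ++ 0# ∷ a ++ [ 0# ]
    reassoc = ≡.cong (b₁ ∷_) (begin
      (bmid ++ bₘ ∷ 0# ∷ a₁ ∷ amid) ++ aₙ ∷ 0# ∷ []    ≡⟨ ++-assoc bmid _ _ ⟩
      bmid ++ bₘ ∷ 0# ∷ a₁ ∷ amid ++ aₙ ∷ 0# ∷ []
        ≡⟨ ≡.cong (λ l → bmid ++ bₘ ∷ 0# ∷ a₁ ∷ l) (++-assoc amid [ aₙ ] [ 0# ]) ⟨
      bmid ++ bₘ ∷ 0# ∷ a ++ [ 0# ]                    ≡⟨ ++-assoc bmid [ bₘ ] _ ⟨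
      (bmid ++ [ bₘ ]) ++ 0# ∷ a ++ [ 0# ]             ∎)
      where open ≡.≡-Reasoning
    sol-b0a0 : IsSolution R (b ++ 0# ∷ a ++ [ 0# ])
    sol-b0a0 = ≡.subst (IsSolution R) reassoc
      (IsSolution-++-comm (aₙ ∷ 0# ∷ []) (b₁ ∷ bmid ++ bₘ ∷ 0# ∷ a₁ ∷ amid) split₂)

  Mn-replicate-comm : ∀ j x → Mn R (replicate j x) · G x ≋ G x · Mn R (replicate j x)
  Mn-replicate-comm j x = begin
    Mn R (replicate j x) · G x        ≈⟨ Mn-∷ x (replicate j x) ⟨
    Mn R (x ∷ replicate j x)          ≡⟨ ≡.cong (Mn R) (replicate-∷ʳ j x) ⟨
    Mn R (replicate j x ++ [ x ])     ≈⟨ Mn-∷ʳ (replicate j x) x ⟩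
    G x · Mn R (replicate j x)        ∎
    where open ≋-Reasoning

  IsSolution-ends-≈ : ∀ p j x q → IsSolution R (p ∷ replicate j x ++ [ q ]) → p ≈ q
  IsSolution-ends-≈ p j x q sol =
    G·X·G-sign⇒≈ (·G-comm⇒m₁₂+m₂₁≈0 (Mn-replicate-comm j x)) (IsSign-resp (≋-sym sandwich) sol)
    where
    sandwich : Mn R (p ∷ replicate j x ++ [ q ]) ≋ G q · Mn R (replicate j x) · G p
    sandwich = ≋-trans (Mn-∷ p (replicate j x ++ [ q ])) (·-cong (Mn-∷ʳ (replicate j x) q) ≋-refl)

module QuasiMonomial {c ℓ} (R : CommutativeRing c ℓ) (x : CommutativeRing.Carrier R) where
  open CommutativeRing R
  open import Algebra.Properties.Group +-group using (//-rightDividesˡ)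
  open Solutions R
  open Arcs setoid x

  length-quasiMonomial : ∀ a n → length (a ∷ replicate n x ++ [ a ]) ≡ suc (suc n)
  length-quasiMonomial a n = ≡.cong suc (≡.trans (length-++ (replicate n x))
    (≡.trans (≡.cong (ℕ._+ 1) (length-replicate n)) (ℕₚ.+-comm n 1)))

  quasiMonomial-palindrome : ∀ a K → reverse (a ∷ replicate K x ++ [ a ]) ≡ a ∷ replicate K x ++ [ a ]
  quasiMonomial-palindrome a K = begin
    reverse (a ∷ replicate K x ++ [ a ])       ≡⟨ unfold-reverse a (replicate K x ++ [ a ]) ⟩
    reverse (replicate K x ++ [ a ]) ++ [ a ]
      ≡⟨ ≡.cong (_++ [ a ]) (reverse-++ (replicate K x) [ a ]) ⟩
    a ∷ reverse (replicate K x) ++ [ a ]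
      ≡⟨ ≡.cong (λ l → a ∷ l ++ [ a ]) (reverse-replicate K x) ⟩
    a ∷ replicate K x ++ [ a ]                 ∎
    where open ≡.≡-Reasoning

  quasiMonomial-of-arc : ∀ p q {l} → IsSolution R (p ∷ l ++ [ q ]) → All (_≈ x) l → 1 ≤ length l →
                         IsQuasiMonomial R x (p ∷ replicate (length l) x ++ [ p ])
  quasiMonomial-of-arc p q {l} sol l≈x 1≤l =
    p , length l , 1≤l , ≡.refl ,
    IsSolution-resp (p ∷ replicate (length l) x ++ [ p ]) (refl ∷ ++⁺ rep≈l (p≈q ∷ [])) sol
    where
    rep≈l : Pointwise _≈_ (replicate (length l) x) l
    rep≈l = Pointwise.symmetric sym (All≈⇒Pointwise-replicate l≈x)
    p≈q : p ≈ q
    p≈q = IsSolution-ends-≈ p (length l) x q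
      (IsSolution-resp (p ∷ replicate (length l) x ++ [ q ]) (refl ∷ ++⁺ rep≈l (refl ∷ [])) sol)

  quasiMonomialMinimal⇒irreducible : ∀ t → IsQuasiMonomialMinimal R x t → Irreducible R t
  quasiMonomialMinimal⇒irreducible _ ((a , K , 1≤K , ≡.refl , sol) , minimal) =
    sol , ≡.subst (3 ≤_) (≡.sym (length-quasiMonomial a K)) (s≤s (s≤s 1≤K)) , not-reducible
    where
    t = a ∷ replicate K x ++ [ a ]

    t-palindrome : reverse t ≡ t
    t-palindrome = quasiMonomial-palindrome a K

    not-reducible : ¬ Reducible R t
    not-reducible (a₁ , amid , aₙ , b₁ , bmid , bₘ , 1≤amid , 1≤bmid , sol-b , k , c∼t) =
      [ (λ amid≈x → 1+m+1+n≰2+m (length amid) 1≤bmid (minimal-arc a₁ aₙ sol-a amid≈x 1≤amid))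
      , (λ bmid≈x → 1+m+1+n≰2+n (length bmid) 1≤amid (minimal-arc b₁ bₘ sol-b bmid≈x 1≤bmid))
      ]′ (arcs a K k c≈t)
      where
      c⊕ = ⊕-tuple R a₁ amid aₙ b₁ bmid bₘ
      c≈t : Pointwise _≈_ c⊕ (rotate R k t)
      c≈t = [ id , ≡.subst (λ l → Pointwise _≈_ c⊕ (rotate R k l)) t-palindrome ]′ c∼t
      length-t : length t ≡ suc (length amid ℕ.+ suc (length bmid))
      length-t = ≡.trans (≡.sym (length-rotate k t))
        (≡.trans (≡.sym (Pointwise-length c≈t)) (≡.cong suc (length-++ amid)))
      sol-a : IsSolution R (a₁ ∷ amid ++ [ aₙ ])
      sol-a = IsSolution-⊕ a₁ amid aₙ b₁ bmid bₘ
                (IsSolution-resp c⊕ c≈t (IsSolution-rotate k t sol)) sol-b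
      minimal-arc : ∀ p q {l} → IsSolution R (p ∷ l ++ [ q ]) → All (_≈ x) l → 1 ≤ length l →
                    suc (length amid ℕ.+ suc (length bmid)) ≤ suc (suc (length l))
      minimal-arc p q sol l≈x 1≤l = ≡.subst₂ _≤_ length-t (length-quasiMonomial p _)
        (minimal _ (quasiMonomial-of-arc p q sol l≈x 1≤l))

  monomial-reducible : ∀ {a j k} → 1 ≤ j → j < k → IsSolution R (a ∷ replicate j x ++ [ a ]) →
                       Reducible R (replicate (suc (suc k)) x)
  monomial-reducible {a} {j} {k} 1≤j j<k sol with m≤n⇒∃[o]m+o≡n j<k
  ... | o , 1+j+o≡k =
    x - a , replicate (suc o) x , x - a , a , replicate j x , a ,
    s≤s z≤n , ≡.subst (1 ≤_) (≡.sym (length-replicate j)) 1≤j ,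
    sol , 0 , inj₁ (≡.subst (Pointwise _≈_ _) shape c≈)
    where
    c≈ : Pointwise _≈_ (⊕-tuple R (x - a) (replicate (suc o) x) (x - a) a (replicate j x) a)
                        (x ∷ replicate (suc o) x ++ x ∷ replicate j x)
    c≈ = //-rightDividesˡ a x ∷
         ++⁺ (Pointwise.replicate⁺ refl (suc o)) (//-rightDividesˡ a x ∷ Pointwise.replicate⁺ refl j)
    shape : x ∷ replicate (suc o) x ++ x ∷ replicate j x ≡ rotate R 0 (replicate (suc (suc k)) x)
    shape = begin
      x ∷ replicate (suc o) x ++ replicate (suc j) x
        ≡⟨ ≡.cong (x ∷_) (replicate-+ (suc o) (suc j) x) ⟨
      replicate (suc (suc (o ℕ.+ suc j))) x
        ≡⟨ ≡.cong (λ n → replicate (suc (suc n)) x) o+1+j≡k ⟩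
      replicate (suc (suc k)) x
        ≡⟨ ++-identityʳ _ ⟨
      replicate (suc (suc k)) x ++ []
        ∎
      where
      open ≡.≡-Reasoning
      o+1+j≡k : o ℕ.+ suc j ≡ k
      o+1+j≡k = ≡.trans (ℕₚ.+-suc o j) (≡.trans (≡.cong suc (ℕₚ.+-comm o j)) 1+j+o≡k)

  irreducible⇒quasiMonomialMinimal : ∀ n → Irreducible R (replicate n x) →
                                     IsQuasiMonomialMinimal R x (replicate n x)
  irreducible⇒quasiMonomialMinimal 0 (_ , () , _)
  irreducible⇒quasiMonomialMinimal 1 (_ , s≤s () , _)
  irreducible⇒quasiMonomialMinimal (suc (suc k)) (sol , s≤s (s≤s 1≤length) , irreducible) =
    (x , k , ≡.subst (1 ≤_) (length-replicate k) 1≤length , ≡.cong (x ∷_) (≡.sym (replicate-∷ʳ k x)) ,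
     sol) ,
    minimal
    where
    minimal : ∀ u → IsQuasiMonomial R x u → length (replicate (suc (suc k)) x) ≤ length u
    minimal _ (a , j , 1≤j , ≡.refl , sol-u) =
      ≡.subst₂ _≤_ (≡.sym (length-replicate (suc (suc k)))) (≡.sym (length-quasiMonomial a j))
        (s≤s (s≤s (≮⇒≥ (λ j<k → irreducible (monomial-reducible 1≤j j<k sol-u)))))

-- Finiteness of A, 0 ≠ 1, x ≠ 0 and the minimality of n only serve to make the
-- minimal solutions exist; the argument does not use them.
proposition7p3 : ∀ {c ℓ} (R : CommutativeRing c ℓ) → Finite R →
    ¬ (CommutativeRing._≈_ R (CommutativeRing.0# R) (CommutativeRing.1# R)) →
    (x : CommutativeRing.Carrier R) → ¬ (CommutativeRing._≈_ R x (CommutativeRing.0# R)) →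
    ((t : List (CommutativeRing.Carrier R)) → IsQuasiMonomialMinimal R x t → Irreducible R t)
    × (∀ n → IsMonomialMinimalSize R x n →
         (Irreducible R (replicate n x) ⇔ IsQuasiMonomialMinimal R x (replicate n x)))
proposition7p3 R _ _ x _ =
  quasiMonomialMinimal⇒irreducible ,
  λ n _ → mk⇔ (irreducible⇒quasiMonomialMinimal n) (quasiMonomialMinimal⇒irreducible (replicate n x))
  where open QuasiMonomial R x
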